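{- Let $k\in\{2,3,6\}$, let $a$ be a positive integer with $ka^2+4=r^2$ for a positive integer $r$, put $b=ka$ and assume $b>10^5$. Let $c=c_2^{\pm}=(ab+4)(a+b\pm 2r)\mp 4r$, and suppose $\{a,b,c\}$ is a $D(4)$-triple, with $ac+4=s^2$, $s$ a positive integer. Then $s\not\equiv a\pmod r$ and $s\not\equiv -a\pmod r$.
   Context: A $D(4)$-triple is a set of three distinct positive integers such that the product of any two distinct elements increased by $4$ is a perfect square. -}

module Defs where

open import Data.Integer using (ℤ; +_; _+_; _-_; _*_; -_; _<_; _^_)
open import Data.Product using (∃-syntax; _×_)
open import Relation.Binary.PropositionalEquality using (_≡_; _≢_)

IsSquare : ℤ → Set
IsSquare n = ∃[ t ] (n ≡ t * t)

D4Triple : ℤ → ℤ → ℤ → Set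
D4Triple a b c =
  (+ 0 < a) × (+ 0 < b) × (+ 0 < c) ×
  (a ≢ b) × (a ≢ c) × (b ≢ c) ×
  IsSquare (a * b + + 4) × IsSquare (a * c + + 4) × IsSquare (b * c + + 4)

-- c₂^± = (ab+4)(a+b ± 2r) ∓ 4r, with ε = +1 for "+" and ε = -1 for "-"
c₂ : ℤ → ℤ → ℤ → ℤ → ℤ
c₂ ε a b r = (a * b + + 4) * (a + b + ε * (+ 2 * r)) - ε * (+ 4 * r)

{-# OPTIONS --safe #-}
module Submission where

-- Since ab + 4 = r², the number a·c₂ + 4 is the square of r(a ± r) ∓ 2, so s ≡ ±2 (mod r).
-- If also s ≡ ±a (mod r), then r divides a − 2 or a + 2; but r² = ka² + 4 > (a + 2)² as soon
-- as a > 4, which follows from ka > 10⁵ and k ≤ 6.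

open import Defs
open import Data.Integer using (ℤ; +_; _+_; _-_; _*_; -_; _<_; _^_; -1ℤ; 1ℤ; +<+)
open import Data.Integer.Divisibility using (_∣_)
open import Data.Integer.Divisibility.Signed as Signed using () renaming (_∣_ to _∣ₛ_)
open import Data.Integer.Properties
  using (i*j≡0⇒i≡0∨j≡0; i-j≡0⇒i≡j; +-inverseʳ; neg-involutive; *-identityˡ; -1*i≡-i;
         +-injective; pos-+; pos-*; *-identityʳ; drop‿+<+)
open import Data.Integer.Tactic.RingSolver using (solve-∀)
import Data.Nat as ℕ
import Data.Nat.Properties as ℕ
import Data.Nat.Divisibility as ℕ
import Data.Nat.Tactic.RingSolver as ℕ
open import Data.Nat using (suc; s≤s; z≤n)
open import Data.Product using (_×_; _,_; proj₁; proj₂; ∃-syntax)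
open import Data.Sum using (_⊎_; inj₁; inj₂)
open import Relation.Binary.PropositionalEquality
open import Relation.Nullary using (¬_)

IsUnit : ℤ → Set
IsUnit u = u ≡ 1ℤ ⊎ u ≡ -1ℤ

unit*unit≡1 : ∀ {u} → IsUnit u → u * u ≡ 1ℤ
unit*unit≡1 (inj₁ refl) = refl
unit*unit≡1 (inj₂ refl) = refl

-unit*unit : ∀ {u v} → IsUnit u → IsUnit v → IsUnit (- (u * v))
-unit*unit (inj₁ refl) (inj₁ refl) = inj₂ refl
-unit*unit (inj₁ refl) (inj₂ refl) = inj₁ refl
-unit*unit (inj₂ refl) (inj₁ refl) = inj₁ refl
-unit*unit (inj₂ refl) (inj₂ refl) = inj₂ refl

i*i≡j*j⇒i≡±j : ∀ i j → i * i ≡ j * j → ∃[ u ] IsUnit u × i ≡ u * j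
i*i≡j*j⇒i≡±j i j i²≡j² with i*j≡0⇒i≡0∨j≡0 (i - j) (begin
    (i - j) * (i + j)  ≡⟨ difference-of-squares i j ⟩
    i * i - j * j      ≡⟨ cong (_- j * j) i²≡j² ⟩
    j * j - j * j      ≡⟨ +-inverseʳ (j * j) ⟩
    + 0                ∎)
  where
  open ≡-Reasoning
  difference-of-squares : ∀ i j → (i - j) * (i + j) ≡ i * i - j * j
  difference-of-squares = solve-∀
... | inj₁ i-j≡0 = 1ℤ , inj₁ refl , trans (i-j≡0⇒i≡j i j i-j≡0) (sym (*-identityˡ j))
... | inj₂ i+j≡0 = -1ℤ , inj₂ refl ,
  trans (i-j≡0⇒i≡j i (- j) (trans (cong (λ x → i + x) (neg-involutive j)) i+j≡0)) (sym (-1*i≡-i j))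

a*c₂+4≡square : ∀ ε a b r → IsUnit ε → a * b + + 4 ≡ r * r →
  a * c₂ ε a b r + + 4 ≡ (r * (a + ε * r) - + 2 * ε) * (r * (a + ε * r) - + 2 * ε)
a*c₂+4≡square ε a b r ε-unit ab+4≡r² = begin
  a * c₂ ε a b r + + 4                   ≡⟨ expansion ε a b r ⟩
  t * t + (a * b + + 4 - r * r) * P - (ε * ε - 1ℤ) * Q
    ≡⟨ cong₂ (λ X E → t * t + (X - r * r) * P - (E - 1ℤ) * Q) ab+4≡r² (unit*unit≡1 ε-unit) ⟩
  t * t + (r * r - r * r) * P - (1ℤ - 1ℤ) * Q ≡⟨ cancellation (t * t) P Q (r * r) ⟩
  t * t                                  ∎
  where
  open ≡-Reasoning
  t P Q : ℤ
  t = r * (a + ε * r) - + 2 * ε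
  P = a * a + + 2 * ε * a * r + a * b + r * r
  Q = (r * r - + 2) * (r * r - + 2)
  expansion : ∀ ε a b r →
    a * ((a * b + + 4) * (a + b + ε * (+ 2 * r)) - ε * (+ 4 * r)) + + 4 ≡
    (r * (a + ε * r) - + 2 * ε) * (r * (a + ε * r) - + 2 * ε)
    + (a * b + + 4 - r * r) * (a * a + + 2 * ε * a * r + a * b + r * r)
    - (ε * ε - 1ℤ) * ((r * r - + 2) * (r * r - + 2))
  expansion = solve-∀
  cancellation : ∀ x P Q y → x + (y - y) * P - (1ℤ - 1ℤ) * Q ≡ x
  cancellation = solve-∀

s≡±[rq∓2]⇒s≡±2-mod : ∀ {ε} r q s → IsUnit ε → ∃[ δ ] IsUnit δ × s ≡ δ * (r * q - + 2 * ε) →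
  ∃[ u ] IsUnit u × r ∣ₛ s - + 2 * u
s≡±[rq∓2]⇒s≡±2-mod {ε} r q s ε-unit (δ , δ-unit , refl) =
  - (ε * δ) , -unit*unit ε-unit δ-unit , Signed.divides (δ * q) (shift ε δ r q)
  where
  shift : ∀ ε δ r q → δ * (r * q - + 2 * ε) - + 2 * - (ε * δ) ≡ δ * q * r
  shift = solve-∀

∣-sub-sub : ∀ {r s d e} → r ∣ₛ s - d → r ∣ₛ s - e → r ∣ₛ d - e
∣-sub-sub {r} {s} {d} {e} r∣s-d r∣s-e =
  subst (r ∣ₛ_) (difference s d e) (Signed.∣m∣n⇒∣m-n r∣s-e r∣s-d)
  where
  difference : ∀ s d e → s - e - (s - d) ≡ d - e
  difference = solve-∀

±2∓a-indivisible : ∀ {A R u e} → 2 ℕ.< A → 2 ℕ.+ A ℕ.< R → IsUnit u → (e ≡ + A ⊎ e ≡ - + A) →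
  ¬ (+ R ∣ + 2 * u - e)
±2∓a-indivisible {suc (suc (suc m))} (s≤s (s≤s (s≤s _))) 5+m<R = cases
  where
  1+m<R : suc m ℕ.< _
  1+m<R = ℕ.<-trans (ℕ.m<n+m (suc m) {4} (s≤s z≤n)) 5+m<R
  -- For A = 3 + m the absolute values of ±2 ∓ A reduce to 1 + m and 5 + m.
  cases : ∀ {u e} → IsUnit u → (e ≡ + (3 ℕ.+ m) ⊎ e ≡ - + (3 ℕ.+ m)) → ¬ (+ _ ∣ + 2 * u - e)
  cases (inj₁ refl) (inj₁ refl) = ℕ.>⇒∤ 1+m<R
  cases (inj₁ refl) (inj₂ refl) = ℕ.>⇒∤ 5+m<R
  cases (inj₂ refl) (inj₁ refl) = ℕ.>⇒∤ 5+m<R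
  cases (inj₂ refl) (inj₂ refl) = ℕ.>⇒∤ 1+m<R

≡±2-mod⇒≢±a-mod : ∀ {A R s e} → 2 ℕ.< A → 2 ℕ.+ A ℕ.< R →
  ∃[ u ] IsUnit u × + R ∣ₛ s - + 2 * u → e ≡ + A ⊎ e ≡ - + A → ¬ (+ R ∣ s - e)
≡±2-mod⇒≢±a-mod {R = R} {s} {e} 2<A 2+A<R (u , u-unit , r∣s-2u) e≡±a r∣s-e =
  ±2∓a-indivisible 2<A 2+A<R u-unit e≡±a
    (Signed.∣⇒∣ᵤ (∣-sub-sub {+ R} {s} {+ 2 * u} {e} r∣s-2u (Signed.∣ᵤ⇒∣ {+ R} {s - e} r∣s-e)))

m*m<n*n⇒m<n : ∀ {m n} → m ℕ.* m ℕ.< n ℕ.* n → m ℕ.< n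
m*m<n*n⇒m<n m²<n² = ℕ.≰⇒> (λ n≤m → ℕ.<⇒≱ m²<n² (ℕ.*-mono-≤ n≤m n≤m))

2+a<r : ∀ {K A R} → 2 ℕ.≤ K → 4 ℕ.< A → K ℕ.* (A ℕ.* A) ℕ.+ 4 ≡ R ℕ.* R → 2 ℕ.+ A ℕ.< R
2+a<r {K} {A} {R} 2≤K 4<A@(s≤s _) ka²+4≡r² = m*m<n*n⇒m<n (begin-strict
  (2 ℕ.+ A) ℕ.* (2 ℕ.+ A)      ≡⟨ square-expansion A ⟩
  A ℕ.* A ℕ.+ 4 ℕ.* A ℕ.+ 4    <⟨ ℕ.+-monoˡ-< 4 (ℕ.+-monoʳ-< (A ℕ.* A) (ℕ.*-monoˡ-< A 4<A)) ⟩
  A ℕ.* A ℕ.+ A ℕ.* A ℕ.+ 4    ≡⟨ double A ⟩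
  2 ℕ.* (A ℕ.* A) ℕ.+ 4        ≤⟨ ℕ.+-monoˡ-≤ 4 (ℕ.*-monoˡ-≤ (A ℕ.* A) 2≤K) ⟩
  K ℕ.* (A ℕ.* A) ℕ.+ 4        ≡⟨ ka²+4≡r² ⟩
  R ℕ.* R                      ∎)
  where
  open ℕ.≤-Reasoning
  square-expansion : ∀ A → (2 ℕ.+ A) ℕ.* (2 ℕ.+ A) ≡ A ℕ.* A ℕ.+ 4 ℕ.* A ℕ.+ 4
  square-expansion = ℕ.solve-∀
  double : ∀ A → A ℕ.* A ℕ.+ A ℕ.* A ℕ.+ 4 ≡ 2 ℕ.* (A ℕ.* A) ℕ.+ 4
  double = ℕ.solve-∀

i^2≡i*i : ∀ i → i ^ 2 ≡ i * i
i^2≡i*i i = cong (λ x → i * x) (*-identityʳ i)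

k*a^2+4≡r^2⇒a*ka+4≡r*r : ∀ {k a r} → k * a ^ 2 + + 4 ≡ r ^ 2 → a * (k * a) + + 4 ≡ r * r
k*a^2+4≡r^2⇒a*ka+4≡r*r {k} {a} {r} ka²+4≡r² =
  trans (regroup k a) (trans (cong (λ x → k * x + + 4) (sym (i^2≡i*i a))) (trans ka²+4≡r² (i^2≡i*i r)))
  where
  regroup : ∀ k a → a * (k * a) + + 4 ≡ k * (a * a) + + 4
  regroup = solve-∀

k*a^2+4≡r^2⇒ℕ : ∀ {K A R} → + K * (+ A) ^ 2 + + 4 ≡ (+ R) ^ 2 → K ℕ.* (A ℕ.* A) ℕ.+ 4 ≡ R ℕ.* R
k*a^2+4≡r^2⇒ℕ {K} {A} {R} ka²+4≡r² = +-injective (begin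
  + (K ℕ.* (A ℕ.* A) ℕ.+ 4)   ≡⟨ pos-+ (K ℕ.* (A ℕ.* A)) 4 ⟩
  + (K ℕ.* (A ℕ.* A)) + + 4   ≡⟨ cong (λ x → x + + 4) (pos-* K (A ℕ.* A)) ⟩
  + K * + (A ℕ.* A) + + 4     ≡⟨ cong (λ x → + K * x + + 4) (pos-square A) ⟨
  + K * (+ A) ^ 2 + + 4       ≡⟨ ka²+4≡r² ⟩
  (+ R) ^ 2                   ≡⟨ pos-square R ⟩
  + (R ℕ.* R)                 ∎)
  where
  open ≡-Reasoning
  pos-square : ∀ n → (+ n) ^ 2 ≡ + (n ℕ.* n)
  pos-square n = trans (i^2≡i*i (+ n)) (sym (pos-* n n))

2<a×2+a<r : ∀ {K A R} → 2 ℕ.≤ K → K ℕ.≤ 6 → + K * (+ A) ^ 2 + + 4 ≡ (+ R) ^ 2 → + 100000 < + K * + A →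
  2 ℕ.< A × 2 ℕ.+ A ℕ.< R
2<a×2+a<r {K} {A} {R} 2≤K K≤6 ka²+4≡r² 10⁵<ka =
  ℕ.≤-trans (ℕ.m≤n+m 3 2) 4<A , 2+a<r 2≤K 4<A (k*a^2+4≡r^2⇒ℕ {K} {A} {R} ka²+4≡r²)
  where
  open ℕ.≤-Reasoning
  4<A : 4 ℕ.< A
  4<A = ℕ.*-cancelˡ-< 6 4 A (begin-strict
    24             <⟨ ℕ.m<n+m 24 {99976} (s≤s z≤n) ⟩
    100000         <⟨ drop‿+<+ (subst (+ 100000 <_) (sym (pos-* K A)) 10⁵<ka) ⟩
    K ℕ.* A        ≤⟨ ℕ.*-monoˡ-≤ A K≤6 ⟩
    6 ℕ.* A        ∎)

k≡2∨3∨6⇒2≤k≤6 : ∀ {k} → k ≡ + 2 ⊎ k ≡ + 3 ⊎ k ≡ + 6 → ∃[ K ] k ≡ + K × 2 ℕ.≤ K × K ℕ.≤ 6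
k≡2∨3∨6⇒2≤k≤6 (inj₁ refl)        = 2 , refl , ℕ.≤-refl , ℕ.m≤m+n 2 4
k≡2∨3∨6⇒2≤k≤6 (inj₂ (inj₁ refl)) = 3 , refl , ℕ.m≤m+n 2 1 , ℕ.m≤m+n 3 3
k≡2∨3∨6⇒2≤k≤6 (inj₂ (inj₂ refl)) = 6 , refl , ℕ.m≤m+n 2 4 , ℕ.≤-refl

proposition3p3 : (k a r b ε c s : ℤ) →
    (k ≡ + 2 ⊎ k ≡ + 3 ⊎ k ≡ + 6) →
    + 0 < a → + 0 < r → k * a ^ 2 + + 4 ≡ r ^ 2 →
    b ≡ k * a → + 100000 < b →
    (ε ≡ 1ℤ ⊎ ε ≡ -1ℤ) → c ≡ c₂ ε a b r →
    D4Triple a b c →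
    + 0 < s → a * c + + 4 ≡ s ^ 2 →
    ¬ (r ∣ (s - a)) × ¬ (r ∣ (s - (- a)))
proposition3p3 k (+ A) (+ R) _ ε _ s k≡2∨3∨6 (+<+ _) (+<+ _) ka²+4≡r² refl 10⁵<b ε-unit refl _ _ ac+4≡s²
  with k≡2∨3∨6⇒2≤k≤6 k≡2∨3∨6
... | K , refl , 2≤K , K≤6 = s≢±a (inj₁ refl) , s≢±a (inj₂ refl)
  where
  a r t : ℤ
  a = + A
  r = + R
  t = r * (a + ε * r) - + 2 * ε
  s*s≡t*t : s * s ≡ t * t
  s*s≡t*t = trans (sym (i^2≡i*i s))
    (trans (sym ac+4≡s²) (a*c₂+4≡square ε a (+ K * a) r ε-unit (k*a^2+4≡r^2⇒a*ka+4≡r*r {+ K} {a} {r} ka²+4≡r²)))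
  s≡±2-mod-r : ∃[ u ] IsUnit u × r ∣ₛ s - + 2 * u
  s≡±2-mod-r = s≡±[rq∓2]⇒s≡±2-mod r (a + ε * r) s ε-unit (i*i≡j*j⇒i≡±j s t s*s≡t*t)
  2<A×2+A<R : 2 ℕ.< A × 2 ℕ.+ A ℕ.< R
  2<A×2+A<R = 2<a×2+a<r {K} {A} {R} 2≤K K≤6 ka²+4≡r² 10⁵<b
  s≢±a : ∀ {e} → e ≡ a ⊎ e ≡ - a → ¬ (r ∣ s - e)
  s≢±a = ≡±2-mod⇒≢±a-mod {A} {R} {s} (proj₁ 2<A×2+A<R) (proj₂ 2<A×2+A<R) s≡±2-mod-r
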